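{- Let $T$ be a pre-Galois word that has an even period, and let $p_e$ be the shortest even period of $T$. If $T[1..p_e]$ is primitive, then $T[1..p_e]$ is a Galois word.
   Context: An integer $p\in[1..|W|]$ is a period of $W$ if $W[i+p]=W[i]$ for all $i\in[1..|W|-p]$. A word is primitive if it is not of the form $U^k$ with $k\ge 2$. Alternating order: for words $S,T$ with $S^\omega\neq T^\omega$ ($X^\omega$ the infinite repetition of $X$), let $j$ be the first position with $S^\omega[j]\neq T^\omega[j]$; $S\prec_{\mathrm{alt}}T$ if $j$ is odd and $S^\omega[j]<T^\omega[j]$, or $j$ is even and $S^\omega[j]>T^\omega[j]$. $S=_{\mathrm{alt}}T$ if $S^\omega=T^\omega$; $\varepsilon\succ_{\mathrm{alt}}X$ for every nonempty $X$. A word is Galois if it is strictly smaller with respect to $\prec_{\mathrm{alt}}$ than all its other cyclic rotations. A word $T$ is pre-Galois if every proper suffix $S$ of $T$ is a prefix of $T$ or satisfies $S\succ_{\mathrm{alt}}T$. -}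

module Defs where

open import Data.Nat using (ℕ; zero; suc; _+_; _≤_; _<_; _%_; NonZero)
open import Data.Nat.DivMod using (m%n<n)
open import Data.List using (List; []; _∷_; length; take; drop; _++_; concat; replicate)
open import Data.Fin using (fromℕ<)
import Data.List as L
open import Data.Maybe using (Maybe; just; nothing)
open import Data.Product using (Σ; ∃; _×_; _,_)
open import Data.Sum using (_⊎_)
open import Data.Empty using (⊥)
open import Data.Unit using (⊤)
open import Relation.Nullary using (¬_)
open import Relation.Binary.PropositionalEquality using (_≡_)

module Words {A : Set} (_<ₐ_ : A → A → Set) where

  -- 0-indexed letter access: at W i = W[i+1] (nothing if out of range)
  at : List A → ℕ → Maybe A
  at []       _       = nothing
  at (x ∷ xs) zero    = just x
  at (x ∷ xs) (suc i) = at xs i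

  IsPeriod : List A → ℕ → Set
  IsPeriod W p = (1 ≤ p) × (p ≤ length W) ×
                 (∀ i → i + p < length W → at W (i + p) ≡ at W i)

  Even : ℕ → Set
  Even n = n % 2 ≡ 0

  Odd : ℕ → Set
  Odd n = n % 2 ≡ 1

  Primitive : List A → Set
  Primitive W = ¬ (Σ (List A) λ U → Σ ℕ λ k → (2 ≤ k) × (W ≡ concat (replicate k U)))

  -- X^ω for nonempty X = x ∷ xs, 0-indexed: X^ω[i+1] = X[(i mod |X|)+1]
  omega : A → List A → ℕ → A
  omega x xs i = L.lookup (x ∷ xs) (fromℕ< (m%n<n i (suc (length xs))))

  -- alternating comparison of infinite words f, g (0-indexed positions k;
  -- 1-indexed position j = k+1 is odd iff k is even)
  AltLtω : (ℕ → A) → (ℕ → A) → Set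
  AltLtω f g = ∃ λ k → (∀ i → i < k → f i ≡ g i) ×
                       ((Even k × (f k <ₐ g k)) ⊎ (Odd k × (g k <ₐ f k)))

  -- S ≺alt T ; the empty word is larger than every nonempty word
  _≺alt_ : List A → List A → Set
  []       ≺alt _        = ⊥
  (x ∷ xs) ≺alt []       = ⊤
  (x ∷ xs) ≺alt (y ∷ ys) = AltLtω (omega x xs) (omega y ys)

  IsPrefix : List A → List A → Set
  IsPrefix S T = Σ (List A) λ U → S ++ U ≡ T

  IsGalois : List A → Set
  IsGalois T = ∀ i → 1 ≤ i → i < length T → T ≺alt (drop i T ++ take i T)

  IsPreGalois : List A → Set
  IsPreGalois T = ∀ i → 1 ≤ i → i ≤ length T →
                  IsPrefix (drop i T) T ⊎ (T ≺alt drop i T)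

{-# OPTIONS --safe #-}
module Submission where

-- Let P = T[1..pe] and u = P^ω, of which T is a prefix. P is Galois as soon as
-- u ≺alt (u shifted by i) for every 0 < i < pe. If i is not a period of T, pre-Galois
-- gives T ≺alt T[i+1..]; the first difference lies inside T[i+1..] (otherwise that
-- suffix would be a prefix of T, making i a period), so it is also the first difference
-- of u and its i-shift. If i is a period, minimality of pe makes i odd and excludes
-- 2i < pe, and primitivity excludes 2i = pe. Then q = pe − i is odd with 2q < pe, hence
-- not a period, and the first difference k of u against its q-shift reappears at q + k
-- as a difference of u against its i-shift with the sides exchanged; the odd offset q
-- restores the alternating orientation.

open import Defs
open import Data.Nat using (ℕ; zero; suc; _+_; _∸_; _≤_; _<_; _%_; z≤n; s≤s; _<?_)
open import Data.Nat.Properties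
open import Data.Nat.DivMod using (m%n<n; [m+n]%n≡m%n; m<n⇒m%n≡m; %-distribˡ-+)
open import Data.Nat.Induction using (<-rec)
open import Data.Nat.Tactic.RingSolver using (solve-∀)
open import Data.List using (List; []; _∷_; length; take; drop; _++_; concat; replicate; lookup)
open import Data.List.Properties using (length-take; length-drop; take++drop≡id; ++-identityʳ; length-++)
open import Data.Fin using (Fin; toℕ; fromℕ<)
import Data.Fin as Fin
open import Data.Fin.Properties using (toℕ-fromℕ<; fromℕ<-cong)
open import Data.Maybe using (just)
open import Data.Maybe.Properties using (just-injective)
open import Data.Product using (Σ; _×_; _,_; proj₁; map₂)
open import Data.Sum using (_⊎_; inj₁; inj₂)
import Data.Sum as Sum
open import Data.Empty using (⊥-elim)
open import Data.Unit using (tt)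
open import Function using (_∘_)
open import Relation.Nullary using (¬_; yes; no)
open import Relation.Binary.PropositionalEquality
open import Relation.Binary.Structures using (IsStrictTotalOrder)
open import Relation.Binary.Definitions using (tri<; tri≈; tri>)

periodic-agree : ∀ {B : Set} {F G : ℕ → B} {p n} → 1 ≤ p →
                 (∀ y → y + p < n → F (y + p) ≡ F y) →
                 (∀ y → y + p < n → G (y + p) ≡ G y) →
                 (∀ y → y < p → y < n → F y ≡ G y) →
                 ∀ y → y < n → F y ≡ G y
periodic-agree {F = F} {G} {p} {n} 1≤p F-rep G-rep below = <-rec (λ y → y < n → F y ≡ G y) step
  where
  step : ∀ y → (∀ {z} → z < y → z < n → F z ≡ G z) → y < n → F y ≡ G y
  step y rec y<n with y <? p
  ... | yes y<p = below y y<p y<n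
  ... | no y≮p = begin
    F y        ≡⟨ cong F (sym z+p≡y) ⟩
    F (z + p)  ≡⟨ F-rep z z+p<n ⟩
    F z        ≡⟨ rec z<y (<-trans z<y y<n) ⟩
    G z        ≡⟨ sym (G-rep z z+p<n) ⟩
    G (z + p)  ≡⟨ cong G z+p≡y ⟩
    G y        ∎
    where
    open ≡-Reasoning
    z = y ∸ p
    z+p≡y : z + p ≡ y
    z+p≡y = m∸n+n≡m (≮⇒≥ y≮p)
    z+p<n : z + p < n
    z+p<n = subst (_< n) (sym z+p≡y) y<n
    z<y : z < y
    z<y = subst (z <_) z+p≡y (m<m+n z 1≤p)

module GaloisWords {A : Set} (_<ₐ_ : A → A → Set) where
  open Words _<ₐ_

  Odd+Even : ∀ m n → Odd m → Even n → Odd (m + n)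
  Odd+Even m n odd-m even-n rewrite %-distribˡ-+ m n 2 {{_}} | odd-m | even-n = refl

  Odd+Odd : ∀ m n → Odd m → Odd n → Even (m + n)
  Odd+Odd m n odd-m odd-n rewrite %-distribˡ-+ m n 2 {{_}} | odd-m | odd-n = refl

  parity : ∀ n → Even n ⊎ Odd n
  parity n with n % 2 | m%n<n n 2
  ... | 0           | _ = inj₁ refl
  ... | 1           | _ = inj₂ refl
  ... | suc (suc _) | s≤s (s≤s ())

  Even-double : ∀ n → Even (n + n)
  Even-double n with parity n
  ... | inj₁ even-n rewrite %-distribˡ-+ n n 2 {{_}} | even-n = refl
  ... | inj₂ odd-n  = Odd+Odd n n odd-n odd-n

  Even+Odd⇒Odd : ∀ m n → Even (m + n) → Odd m → Odd n
  Even+Odd⇒Odd m n even-m+n odd-m with parity n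
  ... | inj₂ odd-n  = odd-n
  ... | inj₁ even-n = ⊥-elim (0≢1+n (trans (sym even-m+n) (Odd+Even m n odd-m even-n)))

  at-lookup : ∀ (W : List A) (i : Fin (length W)) → at W (toℕ i) ≡ just (lookup W i)
  at-lookup (x ∷ W) Fin.zero    = refl
  at-lookup (x ∷ W) (Fin.suc i) = at-lookup W i

  at-take : ∀ k (W : List A) {y} → y < k → at (take k W) y ≡ at W y
  at-take (suc k) []      _         = refl
  at-take (suc k) (x ∷ W) {zero}  _ = refl
  at-take (suc k) (x ∷ W) {suc y} (s≤s y<k) = at-take k W y<k

  at-drop : ∀ k (W : List A) y → at (drop k W) y ≡ at W (y + k)
  at-drop zero    W       y = cong (at W) (sym (+-identityʳ y))
  at-drop (suc k) []      y = refl
  at-drop (suc k) (x ∷ W) y = trans (at-drop k W y) (cong (at (x ∷ W)) (sym (+-suc y k)))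

  at-++ˡ : ∀ (U V : List A) {y} → y < length U → at (U ++ V) y ≡ at U y
  at-++ˡ (x ∷ U) V {zero}  _         = refl
  at-++ˡ (x ∷ U) V {suc y} (s≤s y<U) = at-++ˡ U V y<U

  at-++ʳ : ∀ (U V : List A) z → at (U ++ V) (length U + z) ≡ at V z
  at-++ʳ []      V z = refl
  at-++ʳ (x ∷ U) V z = at-++ʳ U V z

  at-ext : ∀ (U V : List A) → length U ≡ length V →
           (∀ y → y < length U → at U y ≡ at V y) → U ≡ V
  at-ext []      []      _     _     = refl
  at-ext (x ∷ U) (y ∷ V) |U|≡|V| agree =
    cong₂ _∷_ (just-injective (agree 0 (s≤s z≤n)))
              (at-ext U V (suc-injective |U|≡|V|) (λ z z<U → agree (suc z) (s≤s z<U)))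

  <-length-drop : ∀ k (W : List A) {y} → y < length (drop k W) → y + k < length W
  <-length-drop zero    W       {y} y<W = subst (_< length W) (sym (+-identityʳ y)) y<W
  <-length-drop (suc k) (x ∷ W) {y} y<W = subst (_< suc (length W)) (sym (+-suc y k)) (s≤s (<-length-drop k W y<W))

  prefix-at : ∀ {S W : List A} → IsPrefix S W → ∀ y → y < length S → at S y ≡ at W y
  prefix-at {S} (U , refl) y y<S = sym (at-++ˡ S U y<S)

  length-take-≤ : ∀ {k} (W : List A) → k ≤ length W → length (take k W) ≡ k
  length-take-≤ {k} W k≤W = trans (length-take k W) (m≤n⇒m⊓n≡m k≤W)

  rotate : ℕ → List A → List A
  rotate i W = drop i W ++ take i W

  length-rotate : ∀ {i} (W : List A) → i ≤ length W → length (rotate i W) ≡ length W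
  length-rotate {i} W i≤W = begin
    length (drop i W ++ take i W)          ≡⟨ length-++ (drop i W) ⟩
    length (drop i W) + length (take i W)  ≡⟨ cong₂ _+_ (length-drop i W) (length-take-≤ W i≤W) ⟩
    (length W ∸ i) + i                     ≡⟨ m∸n+n≡m i≤W ⟩
    length W                               ∎
    where open ≡-Reasoning

  Repeats : List A → ℕ → Set
  Repeats W p = ∀ y → y + p < length W → at W (y + p) ≡ at W y

  Repeats-+ : ∀ {W p q} → Repeats W p → Repeats W q → Repeats W (p + q)
  Repeats-+ {W} {p} {q} rep-p rep-q y y+[p+q]<W = begin
    at W (y + (p + q))  ≡⟨ cong (at W) (sym (+-assoc y p q)) ⟩
    at W (y + p + q)    ≡⟨ rep-q (y + p) (subst (_< length W) (sym (+-assoc y p q)) y+[p+q]<W) ⟩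
    at W (y + p)        ≡⟨ rep-p y (≤-trans (s≤s (+-monoʳ-≤ y (m≤m+n p q))) y+[p+q]<W) ⟩
    at W y              ∎
    where open ≡-Reasoning

  Repeats-take : ∀ {W p} k → Repeats W p → Repeats (take k W) p
  Repeats-take {W} {p} k rep y y+p<kW = begin
    at (take k W) (y + p)  ≡⟨ at-take k W y+p<k ⟩
    at W (y + p)           ≡⟨ rep y (m<n⊓o⇒m<o k (length W) y+p<k⊓W) ⟩
    at W y                 ≡⟨ sym (at-take k W (≤-trans (s≤s (m≤m+n y p)) y+p<k)) ⟩
    at (take k W) y        ∎
    where
    open ≡-Reasoning
    y+p<k⊓W = subst (y + p <_) (length-take k W) y+p<kW
    y+p<k = m<n⊓o⇒m<n k (length W) y+p<k⊓W

  Repeats-from-drop : ∀ {W} i → (∀ y → y < length (drop i W) → at (drop i W) y ≡ at W y) → Repeats W i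
  Repeats-from-drop {W} i agree y y+i<W = trans (sym (at-drop i W y)) (agree y y<W∸i)
    where
    y<W∸i : y < length (drop i W)
    y<W∸i = subst (y <_) (sym (length-drop i W))
              (subst (_< length W ∸ i) (m+n∸n≡m y i) (∸-monoˡ-< y+i<W (m≤n+m i y)))

  Repeats-square : ∀ {W p} → Repeats W p → p + p ≡ length W → W ≡ concat (replicate 2 (take p W))
  Repeats-square {W} {p} rep p+p≡W = begin
    W                          ≡⟨ sym (take++drop≡id p W) ⟩
    take p W ++ drop p W       ≡⟨ cong (take p W ++_) drop≡take ⟩
    take p W ++ take p W       ≡⟨ cong (take p W ++_) (sym (++-identityʳ (take p W))) ⟩
    take p W ++ (take p W ++ []) ∎
    where
    open ≡-Reasoning
    |drop|≡p : length (drop p W) ≡ p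
    |drop|≡p = trans (length-drop p W) (trans (cong (_∸ p) (sym p+p≡W)) (m+n∸n≡m p p))
    |take|≡p : length (take p W) ≡ p
    |take|≡p = length-take-≤ W (subst (p ≤_) p+p≡W (m≤m+n p p))
    drop≡take : drop p W ≡ take p W
    drop≡take = at-ext (drop p W) (take p W) (trans |drop|≡p (sym |take|≡p)) λ y y<drop → begin
      at (drop p W) y  ≡⟨ at-drop p W y ⟩
      at W (y + p)     ≡⟨ rep y (<-length-drop p W y<drop) ⟩
      at W y           ≡⟨ sym (at-take p W (subst (y <_) |drop|≡p y<drop)) ⟩
      at (take p W) y  ∎

  Periodic : (ℕ → A) → ℕ → Set
  Periodic f p = ∀ y → f (y + p) ≡ f y

  shift : ℕ → (ℕ → A) → ℕ → A
  shift i f y = f (y + i)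

  Periodic-shift : ∀ {f p} i → Periodic f p → Periodic (shift i f) p
  Periodic-shift {f} {p} i f-per y = trans (cong f (y+p+i≡y+i+p y p i)) (f-per (y + i))
    where
    y+p+i≡y+i+p : ∀ y p i → y + p + i ≡ y + i + p
    y+p+i≡y+i+p = solve-∀

  periodic-≗ : ∀ {f g p} → 1 ≤ p → Periodic f p → Periodic g p →
               (∀ y → y < p → f y ≡ g y) → ∀ y → f y ≡ g y
  periodic-≗ 1≤p f-per g-per below y =
    periodic-agree 1≤p (λ z _ → f-per z) (λ z _ → g-per z) (λ z z<p _ → below z z<p) y (n<1+n y)

  infix 4 _⊑ω_
  _⊑ω_ : List A → (ℕ → A) → Set
  W ⊑ω f = ∀ y → y < length W → at W y ≡ just (f y)

  ⊑ω-agree : ∀ {W f g} → W ⊑ω f → W ⊑ω g → ∀ y → y < length W → f y ≡ g y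
  ⊑ω-agree W⊑f W⊑g y y<W = just-injective (trans (sym (W⊑f y y<W)) (W⊑g y y<W))

  Repeats-⊑ω : ∀ {W f p} → W ⊑ω f → Repeats W p → ∀ y → y + p < length W → f (y + p) ≡ f y
  Repeats-⊑ω W⊑f rep y y+p<W =
    just-injective (trans (sym (W⊑f _ y+p<W)) (trans (rep y y+p<W) (W⊑f y y<W)))
    where y<W = ≤-trans (s≤s (m≤m+n _ _)) y+p<W

  ⊑ω-take : ∀ {W f} k → W ⊑ω f → take k W ⊑ω f
  ⊑ω-take {W} k W⊑f y y<kW = trans (at-take k W y<k) (W⊑f y (m<n⊓o⇒m<o k (length W) y<k⊓W))
    where
    y<k⊓W = subst (y <_) (length-take k W) y<kW
    y<k = m<n⊓o⇒m<n k (length W) y<k⊓W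

  ⊑ω-drop : ∀ {W f} i → W ⊑ω f → drop i W ⊑ω shift i f
  ⊑ω-drop {W} i W⊑f y y<drop = trans (at-drop i W y) (W⊑f (y + i) (<-length-drop i W y<drop))

  ⊑ω-rotate : ∀ {W f} i → Periodic f (length W) → W ⊑ω f → i ≤ length W → rotate i W ⊑ω shift i f
  ⊑ω-rotate {W} {f} i f-per W⊑f i≤W y y<rot with y <? length (drop i W)
  ... | yes y<drop = trans (at-++ˡ (drop i W) (take i W) y<drop) (⊑ω-drop i W⊑f y y<drop)
  ... | no y≮drop = begin
    at (drop i W ++ take i W) y        ≡⟨ cong (at (drop i W ++ take i W)) (sym d+z≡y) ⟩
    at (drop i W ++ take i W) (d + z)  ≡⟨ at-++ʳ (drop i W) (take i W) z ⟩
    at (take i W) z                    ≡⟨ at-take i W z<i ⟩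
    at W z                             ≡⟨ W⊑f z (≤-trans z<i i≤W) ⟩
    just (f z)                         ≡⟨ cong just (sym (f-per z)) ⟩
    just (f (z + length W))            ≡⟨ cong (just ∘ f) z+W≡y+i ⟩
    just (f (y + i))                   ∎
    where
    open ≡-Reasoning
    d = length (drop i W)
    z = y ∸ d
    d+z≡y : d + z ≡ y
    d+z≡y = m+[n∸m]≡n (≮⇒≥ y≮drop)
    d+i≡W : d + i ≡ length W
    d+i≡W = trans (cong (_+ i) (length-drop i W)) (m∸n+n≡m i≤W)
    z<i : z < i
    z<i = +-cancelˡ-< d z i
            (subst₂ _<_ (sym d+z≡y) (sym d+i≡W) (subst (y <_) (length-rotate W i≤W) y<rot))
    z+W≡y+i : z + length W ≡ y + i
    z+W≡y+i = begin
      z + length W  ≡⟨ cong (z +_) (sym d+i≡W) ⟩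
      z + (d + i)   ≡⟨ z+[d+i]≡d+z+i z d i ⟩
      d + z + i     ≡⟨ cong (_+ i) d+z≡y ⟩
      y + i         ∎
      where
      z+[d+i]≡d+z+i : ∀ z d i → z + (d + i) ≡ d + z + i
      z+[d+i]≡d+z+i = solve-∀

  omega-⊑ω : ∀ {x xs} → x ∷ xs ⊑ω omega x xs
  omega-⊑ω {x} {xs} y y<X = begin
    at (x ∷ xs) y                        ≡⟨ cong (at (x ∷ xs)) (sym (toℕ-fromℕ< y<X)) ⟩
    at (x ∷ xs) (toℕ (fromℕ< y<X))       ≡⟨ at-lookup (x ∷ xs) (fromℕ< y<X) ⟩
    just (lookup (x ∷ xs) (fromℕ< y<X))  ≡⟨ cong (just ∘ lookup (x ∷ xs)) y≡y%X ⟩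
    just (omega x xs y)                  ∎
    where
    open ≡-Reasoning
    y≡y%X = fromℕ<-cong _ _ (sym (m<n⇒m%n≡m y<X)) y<X (m%n<n y _)

  omega-periodic : ∀ {x xs} → Periodic (omega x xs) (length (x ∷ xs))
  omega-periodic {x} {xs} y = cong (lookup (x ∷ xs)) (fromℕ<-cong _ _ ([m+n]%n≡m%n y (length (x ∷ xs))) _ _)

  omega-unique : ∀ {x xs f} → Periodic f (length (x ∷ xs)) → x ∷ xs ⊑ω f → ∀ y → omega x xs y ≡ f y
  omega-unique f-per X⊑f = periodic-≗ (s≤s z≤n) omega-periodic f-per (⊑ω-agree omega-⊑ω X⊑f)

  periodic-extension : ∀ {W p} → 1 ≤ p → p ≤ length W → Repeats W p →
                       Σ (ℕ → A) λ f → Periodic f p × W ⊑ω f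
  periodic-extension {x ∷ xs} {suc p} _ _ rep = f , f-periodic , W⊑f
    where
    f : ℕ → A
    f y = omega x xs (y % suc p)
    f-periodic : Periodic f (suc p)
    f-periodic y = cong (omega x xs) ([m+n]%n≡m%n y (suc p))
    W⊑f : x ∷ xs ⊑ω f
    W⊑f = periodic-agree (s≤s z≤n) rep (λ y _ → cong just (f-periodic y)) λ y y<p y<W →
      trans (omega-⊑ω y y<W) (cong (just ∘ omega x xs) (sym (m<n⇒m%n≡m y<p)))

  AltLtωAt : ℕ → (ℕ → A) → (ℕ → A) → Set
  AltLtωAt k f g = (∀ i → i < k → f i ≡ g i) × ((Even k × (f k <ₐ g k)) ⊎ (Odd k × (g k <ₐ f k)))

  AltLtωAt-cong : ∀ {k f f′ g g′} → (∀ j → j ≤ k → f j ≡ f′ j) → (∀ j → j ≤ k → g j ≡ g′ j) →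
                  AltLtωAt k f g → AltLtωAt k f′ g′
  AltLtωAt-cong f≡f′ g≡g′ (agree , first) =
    (λ j j<k → trans (sym (f≡f′ j (<⇒≤ j<k))) (trans (agree j j<k) (g≡g′ j (<⇒≤ j<k)))) ,
    Sum.map (map₂ (subst₂ _<ₐ_ (f≡f′ _ ≤-refl) (g≡g′ _ ≤-refl)))
            (map₂ (subst₂ _<ₐ_ (g≡g′ _ ≤-refl) (f≡f′ _ ≤-refl))) first

  ≺alt-from-ω : ∀ (X Y : List A) {f g} → 1 ≤ length X →
                Periodic f (length X) → X ⊑ω f → Periodic g (length Y) → Y ⊑ω g →
                AltLtω f g → X ≺alt Y
  ≺alt-from-ω (x ∷ xs) []       _ _     _   _     _   _          = tt
  ≺alt-from-ω (x ∷ xs) (y ∷ ys) _ f-per X⊑f g-per Y⊑g (k , less) =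
    k , AltLtωAt-cong (λ j _ → sym (omega-unique f-per X⊑f j)) (λ j _ → sym (omega-unique g-per Y⊑g j)) less

  ≺alt⇒AltLtω⊎prefix : ∀ (W S : List A) {f g} → W ⊑ω f → S ⊑ω g → length S ≤ length W → W ≺alt S →
                       AltLtω f g ⊎ (∀ y → y < length S → at S y ≡ at W y)
  ≺alt⇒AltLtω⊎prefix (w ∷ ws) []       _   _   _   _          = inj₂ λ _ ()
  ≺alt⇒AltLtω⊎prefix (w ∷ ws) (s ∷ ss) W⊑f S⊑g S≤W (k , less) with k <? length (s ∷ ss)
  ... | yes k<S = inj₁ (k , AltLtωAt-cong W^ω≡f S^ω≡g less)
    where
    S^ω≡g : ∀ j → j ≤ k → omega s ss j ≡ _
    S^ω≡g j j≤k = ⊑ω-agree omega-⊑ω S⊑g j (<-≤-trans (s≤s j≤k) k<S)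
    W^ω≡f : ∀ j → j ≤ k → omega w ws j ≡ _
    W^ω≡f j j≤k = ⊑ω-agree omega-⊑ω W⊑f j (<-≤-trans (s≤s j≤k) (≤-trans k<S S≤W))
  ... | no k≮S = inj₂ λ y y<S → begin
    at (s ∷ ss) y        ≡⟨ omega-⊑ω y y<S ⟩
    just (omega s ss y)  ≡⟨ cong just (sym (proj₁ less y (<-≤-trans y<S (≮⇒≥ k≮S)))) ⟩
    just (omega w ws y)  ≡⟨ sym (omega-⊑ω y (<-≤-trans y<S S≤W)) ⟩
    at (w ∷ ws) y        ∎
    where open ≡-Reasoning

  IsPreGalois⇒Repeats⊎AltLtω : ∀ {T f} → IsPreGalois T → T ⊑ω f →
                               ∀ i → 1 ≤ i → i ≤ length T → Repeats T i ⊎ AltLtω f (shift i f)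
  IsPreGalois⇒Repeats⊎AltLtω {T} preGalois T⊑f i 1≤i i≤T with preGalois i 1≤i i≤T
  ... | inj₁ prefix = inj₁ (Repeats-from-drop {T} i (prefix-at prefix))
  ... | inj₂ less   =
    Sum.swap (Sum.map₂ (Repeats-from-drop {T} i)
                       (≺alt⇒AltLtω⊎prefix T (drop i T) T⊑f (⊑ω-drop i T⊑f) drop≤T less))
    where
    drop≤T : length (drop i T) ≤ length T
    drop≤T = subst (_≤ length T) (sym (length-drop i T)) (m∸n≤m (length T) i)

  AltLtω-shift-complement : ∀ {f p i q} → Periodic f p → i + q ≡ p → Odd q →
                            (∀ y → y < q → f (y + i) ≡ f y) →
                            AltLtω f (shift q f) → AltLtω f (shift i f)
  AltLtω-shift-complement {f} {i = i} {q} f-per i+q≡p odd-q head (k , agree , first) =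
    q + k , agree′ , Sum.swap (Sum.map first-even first-odd first)
    where
    wrap : ∀ m → f (q + m + i) ≡ f m
    wrap m = trans (cong f (trans (q+m+i≡m+[i+q] q m i) (cong (m +_) i+q≡p))) (f-per m)
      where
      q+m+i≡m+[i+q] : ∀ q m i → q + m + i ≡ m + (i + q)
      q+m+i≡m+[i+q] = solve-∀
    agree′ : ∀ y → y < q + k → f y ≡ f (y + i)
    agree′ y y<q+k with y <? q
    ... | yes y<q = sym (head y y<q)
    ... | no y≮q = begin
      f y            ≡⟨ cong f (sym q+m≡y) ⟩
      f (q + m)      ≡⟨ cong f (+-comm q m) ⟩
      f (m + q)      ≡⟨ sym (agree m (+-cancelˡ-< q m k (subst (_< q + k) (sym q+m≡y) y<q+k))) ⟩
      f m            ≡⟨ sym (wrap m) ⟩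
      f (q + m + i)  ≡⟨ cong (λ y → f (y + i)) q+m≡y ⟩
      f (y + i)      ∎
      where
      open ≡-Reasoning
      m = y ∸ q
      q+m≡y = m+[n∸m]≡n (≮⇒≥ y≮q)
    first-even : Even k × (f k <ₐ f (k + q)) → Odd (q + k) × (f (q + k + i) <ₐ f (q + k))
    first-even (even-k , lt) = Odd+Even q k odd-q even-k , subst₂ _<ₐ_ (sym (wrap k)) (cong f (+-comm k q)) lt
    first-odd : Odd k × (f (k + q) <ₐ f k) → Even (q + k) × (f (q + k) <ₐ f (q + k + i))
    first-odd (odd-k , lt) = Odd+Odd q k odd-q odd-k , subst₂ _<ₐ_ (cong f (+-comm k q)) (sym (wrap k)) lt

  IsGalois-from-shifts : ∀ (P : List A) {f} → Periodic f (length P) → P ⊑ω f →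
                         (∀ i → 1 ≤ i → i < length P → AltLtω f (shift i f)) → IsGalois P
  IsGalois-from-shifts P {f} f-per P⊑f less i 1≤i i<P =
    ≺alt-from-ω P (rotate i P) (≤-trans 1≤i (<⇒≤ i<P)) f-per P⊑f
      (subst (Periodic (shift i f)) (sym (length-rotate P (<⇒≤ i<P))) (Periodic-shift i f-per))
      (⊑ω-rotate i f-per P⊑f (<⇒≤ i<P)) (less i 1≤i i<P)

  module ShortestEvenPeriod
    {T : List A} {pe : ℕ} (preGalois : IsPreGalois T) (pe≤T : pe ≤ length T) (even-pe : Even pe)
    (shortest : ∀ q → IsPeriod T q × Even q → pe ≤ q) (prim : Primitive (take pe T))
    {u : ℕ → A} (u-periodic : Periodic u pe) (T⊑u : T ⊑ω u) where

    short-period-odd : ∀ {j} → 1 ≤ j → j < pe → Repeats T j → Odd j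
    short-period-odd {j} 1≤j j<pe rep with parity j
    ... | inj₂ odd-j  = odd-j
    ... | inj₁ even-j = ⊥-elim (<⇒≱ j<pe (shortest j ((1≤j , ≤-trans (<⇒≤ j<pe) pe≤T , rep) , even-j)))

    no-doubled-short-period : ∀ {j} → 1 ≤ j → j + j < pe → ¬ Repeats T j
    no-doubled-short-period {j} 1≤j j+j<pe rep = 0≢1+n (trans (sym (Even-double j)) odd-j+j)
      where
      odd-j+j : Odd (j + j)
      odd-j+j = short-period-odd (≤-trans 1≤j (m≤m+n j j)) j+j<pe (Repeats-+ {T} {j} {j} rep rep)

    no-half-period : ∀ {i} → i + i ≡ pe → ¬ Repeats T i
    no-half-period {i} i+i≡pe rep =
      prim (take i P , 2 , ≤-refl , Repeats-square (Repeats-take {T} pe rep) i+i≡|P|)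
      where
      P = take pe T
      i+i≡|P| : i + i ≡ length P
      i+i≡|P| = trans i+i≡pe (sym (length-take-≤ T pe≤T))

    AltLtω-shift-past-half : ∀ {i} → 1 ≤ i → i < pe → pe < i + i → Repeats T i → AltLtω u (shift i u)
    AltLtω-shift-past-half {i} 1≤i i<pe pe<i+i rep-i =
      Sum.[ ⊥-elim ∘ no-doubled-short-period 1≤q q+q<pe
          , AltLtω-shift-complement u-periodic i+q≡pe odd-q head ]
        (IsPreGalois⇒Repeats⊎AltLtω preGalois T⊑u q 1≤q (≤-trans (m∸n≤m pe i) pe≤T))
      where
      q = pe ∸ i
      1≤q : 1 ≤ q
      1≤q = m<n⇒0<n∸m i<pe
      i+q≡pe : i + q ≡ pe
      i+q≡pe = m+[n∸m]≡n (<⇒≤ i<pe)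
      q+q<pe : q + q < pe
      q+q<pe = subst (q + q <_) i+q≡pe (+-monoˡ-< q q<i)
        where q<i = +-cancelˡ-< i q i (subst (_< i + i) (sym i+q≡pe) pe<i+i)
      odd-q : Odd q
      odd-q = Even+Odd⇒Odd i q (subst Even (sym i+q≡pe) even-pe) (short-period-odd 1≤i i<pe rep-i)
      head : ∀ y → y < q → u (y + i) ≡ u y
      head y y<q = Repeats-⊑ω {T} T⊑u rep-i y (≤-trans y+i<pe pe≤T)
        where
        y+i<pe : y + i < pe
        y+i<pe = subst (y + i <_) (trans (+-comm q i) i+q≡pe) (+-monoˡ-< i y<q)

    AltLtω-shift : ∀ i → 1 ≤ i → i < pe → AltLtω u (shift i u)
    AltLtω-shift i 1≤i i<pe with IsPreGalois⇒Repeats⊎AltLtω preGalois T⊑u i 1≤i (≤-trans (<⇒≤ i<pe) pe≤T)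
    ... | inj₂ less = less
    ... | inj₁ rep with <-cmp (i + i) pe
    ...   | tri< i+i<pe _ _ = ⊥-elim (no-doubled-short-period 1≤i i+i<pe rep)
    ...   | tri≈ _ i+i≡pe _ = ⊥-elim (no-half-period i+i≡pe rep)
    ...   | tri> _ _ pe<i+i = AltLtω-shift-past-half 1≤i i<pe pe<i+i rep

lemma12 : {A : Set} (_<ₐ_ : A → A → Set) → IsStrictTotalOrder _≡_ _<ₐ_ →
          (T : List A) → Words.IsPreGalois _<ₐ_ T →
          (pe : ℕ) → Words.IsPeriod _<ₐ_ T pe × Words.Even _<ₐ_ pe →
          (∀ q → Words.IsPeriod _<ₐ_ T q × Words.Even _<ₐ_ q → pe ≤ q) →
          Words.Primitive _<ₐ_ (take pe T) →
          Words.IsGalois _<ₐ_ (take pe T)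
lemma12 _<ₐ_ _ T preGalois pe ((1≤pe , pe≤T , repeats) , even-pe) shortest prim
  with u , u-periodic , T⊑u ← GaloisWords.periodic-extension _<ₐ_ {T} 1≤pe pe≤T repeats =
  IsGalois-from-shifts (take pe T) (subst (Periodic u) (sym |P|≡pe) u-periodic) (⊑ω-take pe T⊑u)
    λ i 1≤i i<P → AltLtω-shift i 1≤i (subst (i <_) |P|≡pe i<P)
  where
  open GaloisWords _<ₐ_
  open ShortestEvenPeriod {T} {pe} preGalois pe≤T even-pe shortest prim {u} u-periodic T⊑u
  |P|≡pe : length (take pe T) ≡ pe
  |P|≡pe = length-take-≤ T pe≤T
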